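{- Let $m\ge 2$ be an integer. (1) For $n\ge 0$ let $\widetilde{p_m}(n,t):=t^{ -s_m(n)}p_m(n,t)$. Then $\widetilde{p_m}(n,t)\in\mathbb{N}_0[t^{m-1}]$, i.e. it is a polynomial in $t^{m-1}$ with nonnegative integer coefficients. (2) Let $P_m(n,q):=\widetilde{p_m}(mn,q^{1/(m-1)})$. Then $P_m(n,q)\in\mathbb{N}_0[q]$, $P_m(k,q)=\frac{q^{k+1}-1}{q-1}$ for $k\in\{0,\ldots,m-1\}$, and for $n\ge 2$ \[ P_m(n,q)=q^{1+\nu_m(n)}P_m(n-1,q)+P_m\left(\left\lfloor \tfrac{n}{m}\right\rfloor,q\right), \] where $\nu_m(n)$ is the largest integer $e$ with $m^e\mid n$.
   Context: The $m$-ary partition polynomials $p_m(n,t)$ are defined by the power series expansion $\prod_{j=0}^{\infty}\frac{1}{1-tq^{m^j}}=\sum_{n=0}^{\infty}p_m(n,t)q^n$. $s_m(n)$ denotes the sum of the digits of $n$ in base $m$. -}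

module Defs where

open import Data.Nat using (ℕ; zero; suc; _+_; _*_; _∸_; _^_; _≤?_; NonZero)
open import Data.Nat.DivMod using (_/_; _%_)
open import Relation.Nullary using (yes; no)

-- A formal power series in two variables q, t with ℕ coefficients,
-- represented by its coefficient function:  S n k = [q^n t^k] S.
Series : Set
Series = ℕ → ℕ → ℕ

one : Series
one zero zero = 1
one _    _    = 0

-- mulGeom d F = F · 1/(1 - t q^d) = F · Σ_{a≥0} t^a q^{a d}.
-- H = F/(1 - t q^d) is characterised by H = F + t q^d H, i.e.
-- H(n,k) = F(n,k) + H(n-d,k-1)   (the second term only when n ≥ d, k ≥ 1).
mulGeom : ℕ → Series → Series
mulGeom d F n zero = F n zero
mulGeom d F n (suc k) with d ≤? n
... | yes _ = F n (suc k) + mulGeom d F (n ∸ d) k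
... | no  _ = F n (suc k)

prodUpTo : ℕ → ℕ → Series
prodUpTo m zero    = mulGeom 1 one
prodUpTo m (suc J) = mulGeom (m ^ suc J) (prodUpTo m J)

-- pm m n k = [t^k] p_m(n,t) = [q^n t^k] ∏_{j≥0} 1/(1 - t q^{m^j}).
-- For m ≥ 2 the factors with j > n satisfy m^j > n and do not affect
-- the coefficient of q^n, so truncating the product at J = n is exact.
pm : ℕ → ℕ → ℕ → ℕ
pm m n k = prodUpTo m n n k

-- s_m(n): sum of the base-m digits of n (fuel n suffices for m ≥ 2).
digitSumFuel : ℕ → (m : ℕ) → {{NonZero m}} → ℕ → ℕ
digitSumFuel zero     m n = 0
digitSumFuel (suc f) m n = n % m + digitSumFuel f m (n / m)

s : (m : ℕ) → {{NonZero m}} → ℕ → ℕ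
s m n = digitSumFuel n m n

ptilde : (m : ℕ) → {{NonZero m}} → ℕ → ℕ → ℕ
ptilde m n i = pm m n (s m n + i)

-- [q^j] P_m(n,q) where P_m(n,q) = p̃_m(mn, q^{1/(m-1)}),
-- i.e. the coefficient of t^{(m-1) j} in p̃_m(mn,t).
P : (m : ℕ) → {{NonZero m}} → ℕ → ℕ → ℕ
P m n j = ptilde m (m * n) ((m ∸ 1) * j)

shift : ℕ → (ℕ → ℕ) → ℕ → ℕ
shift d f j with d ≤? j
... | yes _ = f (j ∸ d)
... | no  _ = 0

-- coefficients of (q^{k+1} - 1)/(q - 1) = 1 + q + … + q^k
geomCoeff : ℕ → ℕ → ℕ
geomCoeff k j with j ≤? k
... | yes _ = 1
... | no  _ = 0

-- The series p(q,t) = ∏_{j≥0} 1/(1 − t q^{m^j}) satisfies (1 − tq) p(q,t) = p(q^m,t): the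
-- factor for j = 0 commutes to the front and the remaining factors form p(q^m,t). On
-- coefficients this is p_m(n,t) = t p_m(n−1,t) + [m ∣ n] p_m(n/m,t).
-- Adding 1 to n − 1 causes e = ν_m(n) carries, so s_m(n−1) + 1 = s_m(n) + (m−1)e, while
-- s_m(n) = s_m(n/m) when m ∣ n. Hence by induction every t-degree occurring in p_m(n,t) lies in
-- s_m(n) + (m−1)ℕ, and in the variable q = t^{m−1} the recurrence becomes
-- p̃(n) = q^{ν_m(n)} p̃(n−1) + [m ∣ n] p̃(n/m). At mn, where ν_m(mn) = 1 + ν_m(n), together with
-- p̃(mN + r) = p̃(mN) for r < m (no carries, m ∤ mN + r) this is the recurrence for P_m; the
-- values for k < m are its instances with ν_m(k) = 0 and ⌊k/m⌋ = 0.
module Submission where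

open import Data.Nat
  using (ℕ; zero; suc; _+_; _*_; _∸_; _^_; _≤_; _<_; _≤?_; z≤n; s≤s; _≤′_; ≤′-refl; ≤′-step; NonZero)
open import Data.Nat.Divisibility
  using ( _∣_; divides; _∣?_; _∣0; ∣-refl; ∣⇒≤; m∣m*n; *-pres-∣; ∣m+n∣m⇒∣n; ∣m∸n∣n⇒∣m
        ; n∣m⇒m%n≡0; m%n≡0⇒n∣m )
open import Data.Nat.DivMod
  using ( _/_; _%_; m≡m%n+[m/n]*n; m%n<n; [m+kn]%n≡m%n; m<n⇒m%n≡m; +-distrib-/-∣ˡ; 0/n≡0
        ; m*n/n≡m; m*[n/m]≡n; m<n⇒m/n≡0; m≥n⇒m/n>0; m/n<m )
open import Data.Nat.Induction using (<-rec)
open import Data.Nat.Properties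
open import Algebra.Properties.CommutativeSemigroup +-commutativeSemigroup using (x∙yz≈y∙xz)
open import Algebra.Properties.CommutativeSemigroup *-commutativeSemigroup
  using () renaming (x∙yz≈y∙xz to *-x∙yz≈y∙xz)
open import Data.Product using (_×_; _,_; ∃; ∃₂; ∃-syntax)
open import Data.Sum using (_⊎_; inj₁; inj₂)
open import Relation.Nullary using (¬_; yes; no; contradiction)
open import Relation.Binary.PropositionalEquality

open import Defs

infix 4 _≈_

_≈_ : Series → Series → Set
F ≈ G = ∀ n k → F n k ≡ G n k

≈-sym : ∀ {F G} → F ≈ G → G ≈ F
≈-sym F≈G n k = sym (F≈G n k)

≈-trans : ∀ {F G H} → F ≈ G → G ≈ H → F ≈ H
≈-trans F≈G G≈H n k = trans (F≈G n k) (G≈H n k)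

module _ {d : ℕ} (f : ℕ → ℕ) {j : ℕ} where

  shift-≤ : d ≤ j → shift d f j ≡ f (j ∸ d)
  shift-≤ d≤j with d ≤? j
  ... | yes _   = refl
  ... | no  d≰j = contradiction d≤j d≰j

  shift-≰ : ¬ d ≤ j → shift d f j ≡ 0
  shift-≰ d≰j with d ≤? j
  ... | yes d≤j = contradiction d≤j d≰j
  ... | no  _   = refl

shift-cong : ∀ d {f g} → (∀ x → f x ≡ g x) → ∀ j → shift d f j ≡ shift d g j
shift-cong d f≡g j with d ≤? j
... | yes _ = f≡g (j ∸ d)
... | no  _ = refl

shift-+ : ∀ d f g j → shift d (λ x → f x + g x) j ≡ shift d f j + shift d g j
shift-+ d f g j with d ≤? j
... | yes _ = refl
... | no  _ = refl

shift-shift : ∀ d e f j → shift d (shift e f) j ≡ shift (d + e) f j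
shift-shift d e f j with d ≤? j
... | no d≰j = sym (shift-≰ f (λ d+e≤j → d≰j (m+n≤o⇒m≤o d d+e≤j)))
... | yes d≤j with e ≤? j ∸ d
...   | yes e≤j∸d = trans (cong f (∸-+-assoc j d e))
                      (sym (shift-≤ f (subst (d + e ≤_) (m+[n∸m]≡n d≤j) (+-monoʳ-≤ d e≤j∸d))))
...   | no e≰j∸d =
  sym (shift-≰ f (λ d+e≤j → e≰j∸d (m+n≤o⇒m≤o∸n e (subst (_≤ j) (+-comm d e) d+e≤j))))

shift-comm : ∀ d e f j → shift d (shift e f) j ≡ shift e (shift d f) j
shift-comm d e f j =
  trans (shift-shift d e f j) (trans (cong (λ z → shift z f j) (+-comm d e)) (sym (shift-shift e d f j)))

shift-1-below : ∀ {b f} k → (∀ {x} → x < b → f x ≡ 0) → k ≤ b → shift 1 f k ≡ 0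
shift-1-below zero    _         _   = refl
shift-1-below (suc k) vanishes k<b = vanishes k<b

geomCoeff-suc : ∀ k j → geomCoeff (suc k) j ≡ shift 1 (geomCoeff k) j + geomCoeff 0 j
geomCoeff-suc k zero    = refl
geomCoeff-suc k (suc j) = trans step (sym (+-identityʳ _))
  where
  step : geomCoeff (suc k) (suc j) ≡ geomCoeff k j
  step with suc j ≤? suc k | j ≤? k
  ... | yes _       | yes _   = refl
  ... | no  _       | no  _   = refl
  ... | yes 1+j≤1+k | no  j≰k = contradiction (≤-pred 1+j≤1+k) j≰k
  ... | no  1+j≰1+k | yes j≤k = contradiction (s≤s j≤k) 1+j≰1+k

mulGeom-suc : ∀ d F n k → mulGeom d F n (suc k) ≡ F n (suc k) + shift d (λ x → mulGeom d F x k) n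
mulGeom-suc d F n k with d ≤? n
... | yes _ = refl
... | no  _ = sym (+-identityʳ _)

mulGeom-≥ : ∀ {d n} F k → d ≤ n → mulGeom d F n k ≡ F n k + shift 1 (mulGeom d F (n ∸ d)) k
mulGeom-≥         F zero    _   = sym (+-identityʳ _)
mulGeom-≥ {d} {n} F (suc k) d≤n with d ≤? n
... | yes _   = refl
... | no  d≰n = contradiction d≤n d≰n

mulGeom-< : ∀ {d n} F k → n < d → mulGeom d F n k ≡ F n k
mulGeom-<         F zero    _   = refl
mulGeom-< {d} {n} F (suc k) n<d = trans (mulGeom-suc d F n k)
  (trans (cong (F n (suc k) +_) (shift-≰ (λ x → mulGeom d F x k) (<⇒≱ n<d))) (+-identityʳ _))

mulGeom-unique : ∀ d {F H} → (∀ n → H n 0 ≡ F n 0) →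
                 (∀ n k → H n (suc k) ≡ F n (suc k) + shift d (λ x → H x k) n) →
                 H ≈ mulGeom d F
mulGeom-unique d         H₀ H₊ n zero    = H₀ n
mulGeom-unique d {F} {H} H₀ H₊ n (suc k) =
  trans (H₊ n k) (trans (cong (F n (suc k) +_) (shift-cong d (λ x → mulGeom-unique d H₀ H₊ x k) n))
                        (sym (mulGeom-suc d F n k)))

mulGeom-cong : ∀ d {F G} → F ≈ G → mulGeom d F ≈ mulGeom d G
mulGeom-cong d {F} {G} F≈G = mulGeom-unique d (λ n → F≈G n 0) λ n k →
  trans (mulGeom-suc d F n k) (cong (_+ shift d (λ x → mulGeom d F x k) n) (F≈G n (suc k)))

mulGeom-comm : ∀ d e F → mulGeom e (mulGeom d F) ≈ mulGeom d (mulGeom e F)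
mulGeom-comm d e F = mulGeom-unique d (λ _ → refl) step
  where
  K = mulGeom e (mulGeom d F)

  step : ∀ n k → K n (suc k) ≡ mulGeom e F n (suc k) + shift d (λ x → K x k) n
  cross : ∀ k n → shift d (λ x → mulGeom d F x k) n + shift e (λ x → K x k) n
                ≡ shift e (λ x → mulGeom e F x k) n + shift d (λ x → K x k) n

  step n k = begin
    K n (suc k)
      ≡⟨ mulGeom-suc e (mulGeom d F) n k ⟩
    mulGeom d F n (suc k) + shift e (λ x → K x k) n
      ≡⟨ cong (_+ shift e (λ x → K x k) n) (mulGeom-suc d F n k) ⟩
    (F n (suc k) + shift d (λ x → mulGeom d F x k) n) + shift e (λ x → K x k) n
      ≡⟨ +-assoc (F n (suc k)) _ _ ⟩
    F n (suc k) + (shift d (λ x → mulGeom d F x k) n + shift e (λ x → K x k) n)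
      ≡⟨ cong (F n (suc k) +_) (cross k n) ⟩
    F n (suc k) + (shift e (λ x → mulGeom e F x k) n + shift d (λ x → K x k) n)
      ≡⟨ sym (+-assoc (F n (suc k)) _ _) ⟩
    (F n (suc k) + shift e (λ x → mulGeom e F x k) n) + shift d (λ x → K x k) n
      ≡⟨ cong (_+ shift d (λ x → K x k) n) (sym (mulGeom-suc e F n k)) ⟩
    mulGeom e F n (suc k) + shift d (λ x → K x k) n
      ∎
    where open ≡-Reasoning

  cross zero    n = +-comm (shift d (λ x → F x 0) n) (shift e (λ x → F x 0) n)
  cross (suc k) n = begin
    A + shift e (λ x → K x (suc k)) n
      ≡⟨ cong (A +_) (trans (shift-cong e (λ x → step x k) n) (shift-+ e _ _ n)) ⟩
    A + (B + shift e (shift d (λ x → K x k)) n)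
      ≡⟨ x∙yz≈y∙xz A B _ ⟩
    B + (A + shift e (shift d (λ x → K x k)) n)
      ≡⟨ cong (λ z → B + (A + z)) (shift-comm e d _ n) ⟩
    B + (A + shift d (shift e (λ x → K x k)) n)
      ≡⟨ cong (B +_) (sym (trans (shift-cong d (λ x → mulGeom-suc e (mulGeom d F) x k) n)
                                 (shift-+ d _ _ n))) ⟩
    B + shift d (λ x → K x (suc k)) n
      ∎
    where
    open ≡-Reasoning
    A = shift d (λ x → mulGeom d F x (suc k)) n
    B = shift e (λ x → mulGeom e F x (suc k)) n

-- dil m f and dilate m F are f(q^m) and F(q^m, t)
dil : (m : ℕ) .{{_ : NonZero m}} → (ℕ → ℕ) → ℕ → ℕ
dil m f n with n % m
... | zero  = f (n / m)
... | suc _ = 0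

dilate : (m : ℕ) .{{_ : NonZero m}} → Series → Series
dilate m F n k = dil m (λ x → F x k) n

module _ {m : ℕ} .{{_ : NonZero m}} where

  dil-∣ : ∀ f {n} → m ∣ n → dil m f n ≡ f (n / m)
  dil-∣ f {n} m∣n with n % m | n∣m⇒m%n≡0 n m m∣n
  ... | zero | _ = refl

  dil-∤ : ∀ f {n} → ¬ m ∣ n → dil m f n ≡ 0
  dil-∤ f {n} m∤n with n % m in eq
  ... | zero  = contradiction (m%n≡0⇒n∣m n m eq) m∤n
  ... | suc _ = refl

  dil-* : ∀ f n → dil m f (m * n) ≡ f n
  dil-* f n = trans (dil-∣ f (m∣m*n n)) (cong f (trans (cong (_/ m) (*-comm m n)) (m*n/n≡m n m)))

  dil-cong : ∀ {f g n} → (m ∣ n → f (n / m) ≡ g (n / m)) → dil m f n ≡ dil m g n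
  dil-cong {f} {g} {n} f≡g with m ∣? n
  ... | yes m∣n = trans (dil-∣ f m∣n) (trans (f≡g m∣n) (sym (dil-∣ g m∣n)))
  ... | no  m∤n = trans (dil-∤ f m∤n) (sym (dil-∤ g m∤n))

  dil-+ : ∀ f g n → dil m (λ x → f x + g x) n ≡ dil m f n + dil m g n
  dil-+ f g n with n % m
  ... | zero  = refl
  ... | suc _ = refl

  shift-dil-* : ∀ d f q → shift (m * d) (dil m f) (m * q) ≡ shift d f q
  shift-dil-* d f q with d ≤? q
  ... | yes d≤q = begin
    shift (m * d) (dil m f) (m * q) ≡⟨ shift-≤ (dil m f) (*-monoʳ-≤ m d≤q) ⟩
    dil m f (m * q ∸ m * d)         ≡⟨ cong (dil m f) (sym (*-distribˡ-∸ m q d)) ⟩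
    dil m f (m * (q ∸ d))           ≡⟨ dil-* f (q ∸ d) ⟩
    f (q ∸ d)                       ∎
    where open ≡-Reasoning
  ... | no d≰q = shift-≰ (dil m f) (λ md≤mq → d≰q (*-cancelˡ-≤ m md≤mq))

  shift-dil-∤ : ∀ d f {n} → ¬ m ∣ n → shift (m * d) (dil m f) n ≡ 0
  shift-dil-∤ d f {n} m∤n with m * d ≤? n
  ... | yes md≤n = dil-∤ f (λ m∣n∸md → m∤n (∣m∸n∣n⇒∣m m md≤n m∣n∸md (m∣m*n d)))
  ... | no  _    = refl

  dil-shift : ∀ d f n → dil m (shift d f) n ≡ shift (m * d) (dil m f) n
  dil-shift d f n with m ∣? n
  ... | no  m∤n = trans (dil-∤ (shift d f) m∤n) (sym (shift-dil-∤ d f m∤n))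
  ... | yes m∣n = subst (λ x → dil m (shift d f) x ≡ shift (m * d) (dil m f) x) (m*[n/m]≡n m∣n)
                        (trans (dil-* (shift d f) (n / m)) (sym (shift-dil-* d f (n / m))))

  dilate-one : dilate m one ≈ one
  dilate-one zero    k = trans (dil-∣ (λ x → one x k) (m ∣0)) (cong (λ x → one x k) (0/n≡0 m))
  dilate-one (suc n) k with m ∣? suc n
  ... | no  m∤n = dil-∤ (λ x → one x k) m∤n
  ... | yes m∣n = trans (dil-∣ (λ x → one x k) m∣n) (one-suc (m≥n⇒m/n>0 (∣⇒≤ m∣n)))
    where
    one-suc : ∀ {x} → 0 < x → one x k ≡ 0
    one-suc {suc _} _ = refl

  dilate-mulGeom : ∀ d F → dilate m (mulGeom d F) ≈ mulGeom (m * d) (dilate m F)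
  dilate-mulGeom d F = mulGeom-unique (m * d) (λ _ → refl) λ n k → begin
    dil m (λ x → mulGeom d F x (suc k)) n
      ≡⟨ dil-cong (λ _ → mulGeom-suc d F (n / m) k) ⟩
    dil m (λ x → F x (suc k) + shift d (λ y → mulGeom d F y k) x) n
      ≡⟨ dil-+ (λ x → F x (suc k)) _ n ⟩
    dilate m F n (suc k) + dil m (shift d (λ y → mulGeom d F y k)) n
      ≡⟨ cong (dilate m F n (suc k) +_) (dil-shift d _ n) ⟩
    dilate m F n (suc k) + shift (m * d) (λ x → dilate m (mulGeom d F) x k) n
      ∎
    where open ≡-Reasoning

  mulGeom-*-dilate : ∀ d {F X} → X ≈ mulGeom 1 (dilate m F) →
                     mulGeom (m * d) X ≈ mulGeom 1 (dilate m (mulGeom d F))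
  mulGeom-*-dilate d {F} X≈ =
    ≈-trans (mulGeom-cong (m * d) X≈)
    (≈-trans (mulGeom-comm 1 (m * d) (dilate m F))
             (mulGeom-cong 1 (≈-sym (dilate-mulGeom d F))))

  prodUpTo-suc : ∀ J → prodUpTo m (suc J) ≈ mulGeom 1 (dilate m (prodUpTo m J))
  prodUpTo-suc zero    = mulGeom-*-dilate 1 (mulGeom-cong 1 (≈-sym dilate-one))
  prodUpTo-suc (suc J) = mulGeom-*-dilate (m ^ suc J) (prodUpTo-suc J)

n<m^n : ∀ {m} → 1 < m → ∀ n → n < m ^ n
n<m^n             1<m zero    = s≤s z≤n
n<m^n {m@(suc _)} 1<m (suc n) = begin-strict
  suc n             <⟨ +-monoʳ-< 1 (n<m^n 1<m n) ⟩
  1 + m ^ n         ≤⟨ +-monoˡ-≤ (m ^ n) (m^n>0 m n) ⟩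
  m ^ n + m ^ n     ≡⟨ cong (m ^ n +_) (sym (+-identityʳ (m ^ n))) ⟩
  2 * m ^ n         ≤⟨ *-monoˡ-≤ (m ^ n) 1<m ⟩
  m * m ^ n         ∎
  where open ≤-Reasoning

+-≡0⊎ : ∀ {a b} {P : Set} → a ≡ 0 ⊎ P → b ≡ 0 ⊎ P → a + b ≡ 0 ⊎ P
+-≡0⊎ (inj₁ refl) (inj₁ refl) = inj₁ refl
+-≡0⊎ (inj₂ p)    _           = inj₂ p
+-≡0⊎ (inj₁ _)    (inj₂ p)    = inj₂ p

maximal-power-cofactor : ∀ {m n e} → m ^ e ∣ n → (∀ e′ → m ^ e′ ∣ n → e′ ≤ e) →
                         ∃[ q ] n ≡ q * m ^ e × ¬ m ∣ q
maximal-power-cofactor {m} {n} {e} (divides q n≡qm^e) maximal =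
  q , n≡qm^e , λ m∣q →
    1+n≰n (maximal (suc e) (subst (m ^ suc e ∣_) (sym n≡qm^e) (*-pres-∣ m∣q ∣-refl)))

-- The base is m = 2 + m′, so that NonZero m and m ∸ 1 = suc m′ hold definitionally.
module Base (m′ : ℕ) where

  m : ℕ
  m = suc (suc m′)

  1<m : 1 < m
  1<m = s≤s (s≤s z≤n)

  prodUpTo-stable : ∀ {n J} k → n ≤ J → prodUpTo m J n k ≡ pm m n k
  prodUpTo-stable {n} k n≤J = go (≤⇒≤′ n≤J)
    where
    go : ∀ {J} → n ≤′ J → prodUpTo m J n k ≡ pm m n k
    go ≤′-refl            = refl
    go (≤′-step {J} n≤′J) = trans (mulGeom-< (prodUpTo m J) k n<m^[1+J]) (go n≤′J)
      where
      n<m^[1+J] : n < m ^ suc J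
      n<m^[1+J] = <-≤-trans (n<m^n 1<m n) (^-monoʳ-≤ m (m≤n⇒m≤1+n (≤′⇒≤ n≤′J)))

  pm-suc : ∀ n k → pm m (suc n) k ≡ shift 1 (pm m n) k + dilate m (pm m) (suc n) k
  pm-suc n k = begin
    prodUpTo m (suc n) (suc n) k
      ≡⟨ prodUpTo-suc n (suc n) k ⟩
    mulGeom 1 G (suc n) k
      ≡⟨ mulGeom-≥ G k (s≤s z≤n) ⟩
    G (suc n) k + shift 1 (mulGeom 1 G n) k
      ≡⟨ cong₂ _+_ (dil-cong {m = m} {f = λ x → prodUpTo m n x k} {n = suc n}
                               (λ _ → prodUpTo-stable k (≤-pred (m/n<m (suc n) m 1<m))))
                   (shift-cong 1 (λ k′ → trans (sym (prodUpTo-suc n n k′))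
                                               (prodUpTo-stable k′ (n≤1+n n))) k) ⟩
    dilate m (pm m) (suc n) k + shift 1 (pm m n) k
      ≡⟨ +-comm (dilate m (pm m) (suc n) k) _ ⟩
    shift 1 (pm m n) k + dilate m (pm m) (suc n) k
      ∎
    where
    open ≡-Reasoning
    G = dilate m (prodUpTo m n)

  n≤1+f⇒n/m≤f : ∀ {n f} → n ≤ suc f → n / m ≤ f
  n≤1+f⇒n/m≤f {zero}  _    = z≤n
  n≤1+f⇒n/m≤f {suc n} n≤1+f = ≤-pred (≤-trans (m/n<m (suc n) m 1<m) n≤1+f)

  digitSumFuel-stable : ∀ {f g n} → n ≤ f → n ≤ g → digitSumFuel f m n ≡ digitSumFuel g m n
  digitSumFuel-stable {zero}  {zero}  {zero} _ _ = refl
  digitSumFuel-stable {zero}  {suc g} {zero} _ _ = digitSumFuel-stable {zero} {g} z≤n z≤n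
  digitSumFuel-stable {suc f} {zero}  {zero} _ _ = digitSumFuel-stable {f} {zero} z≤n z≤n
  digitSumFuel-stable {suc f} {suc g} {n} n≤f n≤g =
    cong (n % m +_) (digitSumFuel-stable (n≤1+f⇒n/m≤f n≤f) (n≤1+f⇒n/m≤f n≤g))

  s-step : ∀ n → s m n ≡ n % m + s m (n / m)
  s-step zero    = refl
  s-step (suc n) = cong (suc n % m +_) (digitSumFuel-stable {f = n} (n≤1+f⇒n/m≤f ≤-refl) ≤-refl)

  s-∣ : ∀ {n} → m ∣ n → s m n ≡ s m (n / m)
  s-∣ {n} m∣n = trans (s-step n) (cong (_+ s m (n / m)) (n∣m⇒m%n≡0 n m m∣n))

  s-*-+ : ∀ q {r} → r < m → s m (m * q + r) ≡ r + s m q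
  s-*-+ q {r} r<m = trans (s-step (m * q + r)) (cong₂ _+_ mod div)
    where
    mod : (m * q + r) % m ≡ r
    mod = trans (cong (_% m) (trans (+-comm (m * q) r) (cong (r +_) (*-comm m q))))
                (trans ([m+kn]%n≡m%n r q m) (m<n⇒m%n≡m r<m))
    div : s m ((m * q + r) / m) ≡ s m q
    div = cong (s m) (begin
      (m * q + r) / m   ≡⟨ +-distrib-/-∣ˡ r (m∣m*n q) ⟩
      m * q / m + r / m ≡⟨ cong₂ _+_ (trans (cong (_/ m) (*-comm m q)) (m*n/n≡m q m)) (m<n⇒m/n≡0 r<m) ⟩
      q + 0             ≡⟨ +-identityʳ q ⟩
      q                 ∎)
      where open ≡-Reasoning

  s-* : ∀ q → s m (m * q) ≡ s m q
  s-* q = trans (cong (s m) (sym (+-identityʳ (m * q)))) (s-*-+ q (s≤s z≤n))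

  -- incrementing n in base m causes e carries, each turning a digit m ∸ 1 into 0
  Carries : ℕ → ℕ → Set
  Carries n e = s m n + 1 ≡ s m (suc n) + (m ∸ 1) * e

  carries-none : ∀ q {r} → suc r < m → Carries (m * q + r) 0
  carries-none q {r} 1+r<m = begin
    s m (m * q + r) + 1                ≡⟨ cong (_+ 1) (s-*-+ q (<-trans (n<1+n r) 1+r<m)) ⟩
    r + s m q + 1                      ≡⟨ +-comm _ 1 ⟩
    suc r + s m q                      ≡⟨ sym (s-*-+ q 1+r<m) ⟩
    s m (m * q + suc r)                ≡⟨ cong (s m) (+-suc (m * q) r) ⟩
    s m (suc (m * q + r))              ≡⟨ sym (+-identityʳ _) ⟩
    s m (suc (m * q + r)) + 0          ≡⟨ cong (s m (suc (m * q + r)) +_) (sym (*-zeroʳ (m ∸ 1))) ⟩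
    s m (suc (m * q + r)) + (m ∸ 1) * 0 ∎
    where open ≡-Reasoning

  carries-suc : ∀ {n n′ e} → suc n′ ≡ m * suc n → Carries n e → Carries n′ (suc e)
  carries-suc {n} {n′} {e} 1+n′≡m[1+n] carries = begin
    s m n′ + 1                               ≡⟨ cong (λ x → s m x + 1) n′≡mn+m∸1 ⟩
    s m (m * n + (m ∸ 1)) + 1                ≡⟨ cong (_+ 1) (s-*-+ n ≤-refl) ⟩
    (m ∸ 1) + s m n + 1                      ≡⟨ +-assoc (m ∸ 1) (s m n) 1 ⟩
    (m ∸ 1) + (s m n + 1)                    ≡⟨ cong ((m ∸ 1) +_) carries ⟩
    (m ∸ 1) + (s m (suc n) + (m ∸ 1) * e)    ≡⟨ x∙yz≈y∙xz (m ∸ 1) (s m (suc n)) _ ⟩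
    s m (suc n) + ((m ∸ 1) + (m ∸ 1) * e)    ≡⟨ cong (s m (suc n) +_) (sym (*-suc (m ∸ 1) e)) ⟩
    s m (suc n) + (m ∸ 1) * suc e            ≡⟨ cong (λ x → x + (m ∸ 1) * suc e) s[1+n]≡s[1+n′] ⟩
    s m (suc n′) + (m ∸ 1) * suc e           ∎
    where
    open ≡-Reasoning
    n′≡mn+m∸1 : n′ ≡ m * n + (m ∸ 1)
    n′≡mn+m∸1 = trans (suc-injective (trans 1+n′≡m[1+n] (*-suc m n))) (+-comm (m ∸ 1) (m * n))
    s[1+n]≡s[1+n′] : s m (suc n) ≡ s m (suc n′)
    s[1+n]≡s[1+n′] = sym (trans (cong (s m) 1+n′≡m[1+n]) (s-* (suc n)))

  div-mod : ∀ n → n ≡ m * (n / m) + n % m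
  div-mod n = trans (m≡m%n+[m/n]*n n m) (trans (+-comm (n % m) _) (cong (_+ n % m) (*-comm (n / m) m)))

  ∤⇒nonzero-digit : ∀ {n} → ¬ m ∣ n → ∃₂ λ q r → n ≡ m * q + suc r × suc r < m
  ∤⇒nonzero-digit {n} m∤n with n % m in eq | div-mod n | m%n<n n m
  ... | zero  | _            | _   = contradiction (m%n≡0⇒n∣m n m eq) m∤n
  ... | suc r | n≡m[n/m]+1+r | r<m = n / m , r , n≡m[n/m]+1+r , r<m

  carries-valuation : ∀ {n q} e → suc n ≡ q * m ^ e → ¬ m ∣ q → Carries n e
  carries-valuation {n} {q} zero 1+n≡q m∤q
    with ∤⇒nonzero-digit (subst (λ x → ¬ m ∣ x) (sym (trans 1+n≡q (*-identityʳ q))) m∤q)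
  ... | Q , r , 1+n≡mQ+1+r , 1+r<m =
    subst (λ x → Carries x 0) (sym (suc-injective (trans 1+n≡mQ+1+r (+-suc (m * Q) r))))
          (carries-none Q 1+r<m)
  carries-valuation {n} {q} (suc e) 1+n≡qm^[1+e] m∤q with q * m ^ e in eq
  ... | zero  = contradiction (trans 1+n≡m[qm^e] (trans (cong (m *_) eq) (*-zeroʳ m))) 1+n≢0
    where 1+n≡m[qm^e] = trans 1+n≡qm^[1+e] (*-x∙yz≈y∙xz q m (m ^ e))
  ... | suc Q = carries-suc 1+n≡m[1+Q] (carries-valuation e (sym eq) m∤q)
    where 1+n≡m[1+Q] = trans 1+n≡qm^[1+e] (trans (*-x∙yz≈y∙xz q m (m ^ e)) (cong (m *_) eq))

  valuation : ∀ n → ∃₂ λ q e → suc n ≡ q * m ^ e × ¬ m ∣ q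
  valuation = <-rec _ step
    where
    step : ∀ n → (∀ {n′} → n′ < n → ∃₂ λ q e → suc n′ ≡ q * m ^ e × ¬ m ∣ q) →
           ∃₂ λ q e → suc n ≡ q * m ^ e × ¬ m ∣ q
    step n rec with m ∣? suc n
    ... | no  m∤1+n = suc n , 0 , sym (*-identityʳ (suc n)) , m∤1+n
    ... | yes m∣1+n with suc n / m | m*[n/m]≡n m∣1+n | m≥n⇒m/n>0 (∣⇒≤ m∣1+n) | m/n<m (suc n) m 1<m
    ...   | suc Q | m[1+Q]≡1+n | _ | 1+Q<1+n with rec (≤-pred 1+Q<1+n)
    ...     | q , e , 1+Q≡qm^e , m∤q =
      q , suc e , trans (sym m[1+Q]≡1+n) (trans (cong (m *_) 1+Q≡qm^e) (*-x∙yz≈y∙xz m q (m ^ e))) , m∤q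

  carries-exists : ∀ n → ∃ (Carries n)
  carries-exists n with valuation n
  ... | q , e , 1+n≡qm^e , m∤q = e , carries-valuation e 1+n≡qm^e m∤q

  Admissible : ℕ → ℕ → Set
  Admissible n k = ∃[ j ] k ≡ s m n + (m ∸ 1) * j

  pm-support : ∀ n k → pm m n k ≡ 0 ⊎ Admissible n k
  pm-support = <-rec _ step
    where
    step : ∀ n → (∀ {n′} → n′ < n → ∀ k → pm m n′ k ≡ 0 ⊎ Admissible n′ k) →
           ∀ k → pm m n k ≡ 0 ⊎ Admissible n k
    step zero    _   zero    = inj₂ (0 , sym (*-zeroʳ (m ∸ 1)))
    step zero    _   (suc k) = inj₁ refl
    step (suc n) rec k       = subst (λ x → x ≡ 0 ⊎ Admissible (suc n) k) (sym (pm-suc n k))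
                                     (+-≡0⊎ (shifted k) (dilated k))
      where
      dilated : ∀ k → dilate m (pm m) (suc n) k ≡ 0 ⊎ Admissible (suc n) k
      dilated k with m ∣? suc n
      ... | no  m∤1+n = inj₁ (dil-∤ (λ x → pm m x k) m∤1+n)
      ... | yes m∣1+n with rec (m/n<m (suc n) m 1<m) k
      ...   | inj₁ vanishes   = inj₁ (trans (dil-∣ (λ x → pm m x k) m∣1+n) vanishes)
      ...   | inj₂ (j , k≡)   = inj₂ (j , trans k≡ (cong (_+ (m ∸ 1) * j) (sym (s-∣ m∣1+n))))

      shifted : ∀ k → shift 1 (pm m n) k ≡ 0 ⊎ Admissible (suc n) k
      shifted zero     = inj₁ refl
      shifted (suc k) with rec (n<1+n n) k | carries-exists n
      ... | inj₁ vanishes | _           = inj₁ vanishes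
      ... | inj₂ (j , k≡) | e , carries = inj₂ (e + j , (begin
        suc k                                      ≡⟨ cong suc k≡ ⟩
        suc (s m n + (m ∸ 1) * j)                  ≡⟨ cong (_+ (m ∸ 1) * j) (+-comm 1 (s m n)) ⟩
        s m n + 1 + (m ∸ 1) * j                    ≡⟨ cong (_+ (m ∸ 1) * j) carries ⟩
        s m (suc n) + (m ∸ 1) * e + (m ∸ 1) * j    ≡⟨ +-assoc (s m (suc n)) _ _ ⟩
        s m (suc n) + ((m ∸ 1) * e + (m ∸ 1) * j)  ≡⟨ cong (s m (suc n) +_) (sym (*-distribˡ-+ (m ∸ 1) e j)) ⟩
        s m (suc n) + (m ∸ 1) * (e + j)            ∎))
        where open ≡-Reasoning

  pm-below : ∀ n {k} → k < s m n → pm m n k ≡ 0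
  pm-below n {k} k<sn with pm-support n k
  ... | inj₁ vanishes = vanishes
  ... | inj₂ (j , k≡) = contradiction (subst (s m n ≤_) (sym k≡) (m≤m+n (s m n) _)) (<⇒≱ k<sn)

  ptilde-∤ : ∀ n {i} → ¬ (m ∸ 1) ∣ i → ptilde m n i ≡ 0
  ptilde-∤ n {i} ∤i with pm-support n (s m n + i)
  ... | inj₁ vanishes = vanishes
  ... | inj₂ (j , sn+i≡) =
    contradiction (divides j (trans (+-cancelˡ-≡ (s m n) _ _ sn+i≡) (*-comm (m ∸ 1) j))) ∤i

  ptildeQ : ℕ → ℕ → ℕ
  ptildeQ n j = ptilde m n ((m ∸ 1) * j)

  ptildeQ-suc : ∀ n e → Carries n e →
                ∀ j → ptildeQ (suc n) j ≡ shift e (ptildeQ n) j + dilate m ptildeQ (suc n) j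
  ptildeQ-suc n e carries j = trans (pm-suc n K) (cong₂ _+_ lowered dilated)
    where
    K = s m (suc n) + (m ∸ 1) * j

    dilated : dilate m (pm m) (suc n) K ≡ dilate m ptildeQ (suc n) j
    dilated = dil-cong {m = m} {n = suc n} λ m∣1+n →
      cong (λ x → pm m (suc n / m) (x + (m ∸ 1) * j)) (s-∣ m∣1+n)

    lowered : shift 1 (pm m n) K ≡ shift e (ptildeQ n) j
    lowered with e ≤? j
    ... | yes e≤j = begin
      shift 1 (pm m n) K
        ≡⟨ cong (λ x → shift 1 (pm m n) (s m (suc n) + (m ∸ 1) * x)) (sym (m+[n∸m]≡n e≤j)) ⟩
      shift 1 (pm m n) (s m (suc n) + (m ∸ 1) * (e + (j ∸ e)))
        ≡⟨ cong (shift 1 (pm m n)) K≡ ⟩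
      ptildeQ n (j ∸ e)
        ∎
      where
      open ≡-Reasoning
      K≡ : s m (suc n) + (m ∸ 1) * (e + (j ∸ e)) ≡ suc (s m n + (m ∸ 1) * (j ∸ e))
      K≡ = begin
        s m (suc n) + (m ∸ 1) * (e + (j ∸ e))              ≡⟨ cong (s m (suc n) +_) (*-distribˡ-+ (m ∸ 1) e (j ∸ e)) ⟩
        s m (suc n) + ((m ∸ 1) * e + (m ∸ 1) * (j ∸ e))    ≡⟨ sym (+-assoc (s m (suc n)) _ _) ⟩
        s m (suc n) + (m ∸ 1) * e + (m ∸ 1) * (j ∸ e)      ≡⟨ cong (_+ (m ∸ 1) * (j ∸ e)) (sym carries) ⟩
        s m n + 1 + (m ∸ 1) * (j ∸ e)                      ≡⟨ cong (_+ (m ∸ 1) * (j ∸ e)) (+-comm (s m n) 1) ⟩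
        suc (s m n + (m ∸ 1) * (j ∸ e))                    ∎
    ... | no e≰j = shift-1-below K (pm-below n) (≤-pred (begin-strict
      s m (suc n) + (m ∸ 1) * j   <⟨ +-monoʳ-< (s m (suc n)) (*-monoʳ-< (m ∸ 1) (≰⇒> e≰j)) ⟩
      s m (suc n) + (m ∸ 1) * e   ≡⟨ sym carries ⟩
      s m n + 1                   ≡⟨ +-comm (s m n) 1 ⟩
      suc (s m n)                 ∎))
      where open ≤-Reasoning

  ptildeQ-+ : ∀ q {r} → r < m → ∀ j → ptildeQ (m * q + r) j ≡ ptildeQ (m * q) j
  ptildeQ-+ q {zero}  _     j = cong (λ x → ptildeQ x j) (+-identityʳ (m * q))
  ptildeQ-+ q {suc r} 1+r<m j = begin
    ptildeQ (m * q + suc r) j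
      ≡⟨ cong (λ x → ptildeQ x j) (+-suc (m * q) r) ⟩
    ptildeQ (suc (m * q + r)) j
      ≡⟨ ptildeQ-suc (m * q + r) 0 (carries-none q 1+r<m) j ⟩
    ptildeQ (m * q + r) j + dilate m ptildeQ (suc (m * q + r)) j
      ≡⟨ cong (ptildeQ (m * q + r) j +_) (dil-∤ (λ x → ptildeQ x j) m∤) ⟩
    ptildeQ (m * q + r) j + 0
      ≡⟨ +-identityʳ _ ⟩
    ptildeQ (m * q + r) j
      ≡⟨ ptildeQ-+ q (<-trans (n<1+n r) 1+r<m) j ⟩
    ptildeQ (m * q) j
      ∎
    where
    open ≡-Reasoning
    m∤ : ¬ m ∣ suc (m * q + r)
    m∤ m∣ = <⇒≱ 1+r<m (∣⇒≤ (∣m+n∣m⇒∣n (subst (m ∣_) (sym (+-suc (m * q) r)) m∣) (m∣m*n q)))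

  P-suc : ∀ {N q} e → suc N ≡ q * m ^ e → ¬ m ∣ q →
          ∀ j → P m (suc N) j ≡ shift (1 + e) (P m N) j + P m (suc N / m) j
  P-suc {N} e 1+N≡qm^e m∤q j = begin
    ptildeQ (m * suc N) j
      ≡⟨ cong (λ x → ptildeQ x j) (sym 1+n′≡m[1+N]) ⟩
    ptildeQ (suc n′) j
      ≡⟨ ptildeQ-suc n′ (1 + e) (carries-suc 1+n′≡m[1+N] (carries-valuation e 1+N≡qm^e m∤q)) j ⟩
    shift (1 + e) (ptildeQ n′) j + dilate m ptildeQ (suc n′) j
      ≡⟨ cong₂ _+_ (shift-cong (1 + e) (ptildeQ-+ N ≤-refl) j)
                   (cong (λ x → dilate m ptildeQ x j) 1+n′≡m[1+N]) ⟩
    shift (1 + e) (P m N) j + dilate m ptildeQ (m * suc N) j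
      ≡⟨ cong (shift (1 + e) (P m N) j +_) quotient ⟩
    shift (1 + e) (P m N) j + P m (suc N / m) j
      ∎
    where
    open ≡-Reasoning
    n′ = m * N + (m ∸ 1)
    1+n′≡m[1+N] : suc n′ ≡ m * suc N
    1+n′≡m[1+N] = sym (trans (*-suc m N) (cong suc (+-comm (m ∸ 1) (m * N))))
    quotient : dilate m ptildeQ (m * suc N) j ≡ P m (suc N / m) j
    quotient = begin
      dilate m ptildeQ (m * suc N) j                         ≡⟨ dil-* {m = m} (λ x → ptildeQ x j) (suc N) ⟩
      ptildeQ (suc N) j                                      ≡⟨ cong (λ x → ptildeQ x j) (div-mod (suc N)) ⟩
      ptildeQ (m * (suc N / m) + suc N % m) j                ≡⟨ ptildeQ-+ (suc N / m) (m%n<n (suc N) m) j ⟩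
      ptildeQ (m * (suc N / m)) j                            ∎

  ptildeQ-zero : ∀ j → ptildeQ 0 j ≡ geomCoeff 0 j
  ptildeQ-zero zero    = cong (pm m 0) (*-zeroʳ (m ∸ 1))
  ptildeQ-zero (suc j) = refl

  P-geom : ∀ k → k < m → ∀ j → P m k j ≡ geomCoeff k j
  P-geom zero    _     j = trans (cong (λ x → ptildeQ x j) (*-zeroʳ m)) (ptildeQ-zero j)
  P-geom (suc k) 1+k<m j = begin
    P m (suc k) j
      ≡⟨ P-suc 0 (sym (*-identityʳ (suc k))) (λ m∣1+k → <⇒≱ 1+k<m (∣⇒≤ m∣1+k)) j ⟩
    shift 1 (P m k) j + P m (suc k / m) j
      ≡⟨ cong₂ _+_ (shift-cong 1 (P-geom k (<-trans (n<1+n k) 1+k<m)) j)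
                   (trans (cong (λ x → P m x j) (m<n⇒m/n≡0 1+k<m)) (P-geom 0 (s≤s z≤n) j)) ⟩
    shift 1 (geomCoeff k) j + geomCoeff 0 j
      ≡⟨ sym (geomCoeff-suc k j) ⟩
    geomCoeff (suc k) j
      ∎
    where open ≡-Reasoning

theorem4p5 : (m : ℕ) {{_ : NonZero m}} → 2 ≤ m →
    -- (1) t^(-s_m(n)) p_m(n,t) is in N0[t^(m-1)]
    (∀ (n : ℕ) →
        (∀ (k : ℕ) → k < s m n → pm m n k ≡ 0)
      × (∀ (i : ℕ) → ¬ ((m ∸ 1) ∣ i) → ptilde m n i ≡ 0))
    -- (2a) P_m(n,q) ∈ ℕ₀[q]: no fractional powers of q occur
    × (∀ (n : ℕ) → (∀ (k : ℕ) → k < s m (m * n) → pm m (m * n) k ≡ 0)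
                 × (∀ (i : ℕ) → ¬ ((m ∸ 1) ∣ i) → ptilde m (m * n) i ≡ 0))
    -- (2b) P_m(k,q) = (q^(k+1) - 1)/(q - 1) for 0 ≤ k ≤ m-1
    × (∀ (k : ℕ) → k < m → ∀ (j : ℕ) → P m k j ≡ geomCoeff k j)
    -- (2c) recurrence, e = ν_m(n) the largest e with m^e ∣ n
    × (∀ (n : ℕ) → 2 ≤ n → ∀ (e : ℕ) → (m ^ e) ∣ n →
         (∀ (e' : ℕ) → (m ^ e') ∣ n → e' ≤ e) →
         ∀ (j : ℕ) → P m n j ≡ shift (1 + e) (P m (n ∸ 1)) j + P m (n / m) j)
theorem4p5 (suc (suc m′)) (s≤s (s≤s z≤n)) =
  supported , (λ n → supported (m * n)) , P-geom , recurrence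
  where
  open Base m′
  supported : ∀ n → (∀ k → k < s m n → pm m n k ≡ 0) × (∀ i → ¬ (m ∸ 1) ∣ i → ptilde m n i ≡ 0)
  supported n = (λ _ → pm-below n) , (λ _ → ptilde-∤ n)
  recurrence : ∀ n → 2 ≤ n → ∀ e → m ^ e ∣ n → (∀ e′ → m ^ e′ ∣ n → e′ ≤ e) →
               ∀ j → P m n j ≡ shift (1 + e) (P m (n ∸ 1)) j + P m (n / m) j
  recurrence (suc N) _ e m^e∣n maximal with maximal-power-cofactor m^e∣n maximal
  ... | q , 1+N≡qm^e , m∤q = P-suc e 1+N≡qm^e m∤q
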